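{- Let $n\ge1$. The $n$-dimensional simplicial associahedron can be obtained by successive stellar subdivisions of edges of the $n$-dimensional cross-polytope; that is, the simplicial complex whose vertices are the diagonals of a convex $(n+3)$-gon and whose facets are its triangulations (maximal sets of pairwise non-crossing diagonals) is isomorphic to a complex obtained from the boundary complex of the $n$-dimensional cross-polytope by a finite sequence of stellar subdivisions of edges. Equivalently, the polar dual (simple) associahedron can be obtained by successive truncations of codimension-$2$ faces of the $n$-dimensional cube.
   Context: For a simplicial complex $\Delta$ and a face $f$, the stellar subdivision of $f$ in $\Delta$ is the complex $\{f'\in\Delta : f\not\subseteq f'\}\cup\{f'\cup\{a\} : f\not\subseteq f',\ f'\cup f\in\Delta\}$ where $a$ is a new vertex; a stellar subdivision of an edge is the case $|f|=2$. Two diagonals $(a,b)$, $(c,d)$ ($a<b$, $c<d$, vertices labeled cyclically) cross if $a<c<b<d$ or $c<a<d<b$. -}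

module Defs where

open import Data.Nat using (ℕ; zero; suc; _+_; _≤_; _<_; _≡ᵇ_)
open import Data.Bool using (Bool; true; false; _∨_; _∧_; not; T)
open import Data.Fin using (Fin; _↑ˡ_; _↑ʳ_)
open import Data.Maybe using (Maybe; just; nothing)
open import Data.Product using (Σ; _×_; ∃; ∃-syntax)
open import Data.Sum using (_⊎_)
open import Function using (_∘_)
open import Function.Bundles using (_⤖_; _⇔_; Bijection)
open import Relation.Nullary using (¬_)
open import Relation.Binary.PropositionalEquality using (_≡_; _≢_)

Face : Set → Set
Face V = V → Bool

Complex : Set → Set₁
Complex V = Face V → Set

_⊆_ : {V : Set} → Face V → Face V → Set
f ⊆ g = ∀ x → f x ≡ true → g x ≡ true

_∪_ : {V : Set} → Face V → Face V → Face V
(f ∪ g) x = f x ∨ g x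

IsTwoSet : {V : Set} → Face V → Set
IsTwoSet {V} f = Σ V λ u → Σ V λ v → u ≢ v ×
  (∀ x → (f x ≡ true → (x ≡ u ⊎ x ≡ v)) × ((x ≡ u ⊎ x ≡ v) → f x ≡ true))

IsEdge : {V : Set} → Complex V → Face V → Set
IsEdge Δ f = Δ f × IsTwoSet f

-- Stellar subdivision of the face f in Δ; the new vertex a is `nothing`.
--   { f' ∈ Δ : f ⊄ f' } ∪ { f' ∪ {a} : f ⊄ f', f' ∪ f ∈ Δ }
stellar : {V : Set} → Complex V → Face V → Complex (Maybe V)
stellar Δ f F =
    (F nothing ≡ false × ¬ (f ⊆ (F ∘ just)) × Δ (F ∘ just))
  ⊎ (F nothing ≡ true  × ¬ (f ⊆ (F ∘ just)) × Δ ((F ∘ just) ∪ f))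

-- Boundary complex of the n-dimensional cross-polytope:
-- vertices ±e_i, i < n, encoded as i ↑ˡ n (= +e_i) and n ↑ʳ i (= -e_i);
-- faces are the sets containing no antipodal pair.

crossPolytope : (n : ℕ) → Complex (Fin (n + n))
crossPolytope n F = ∀ (i : Fin n) → ¬ (F (i ↑ˡ n) ≡ true × F (n ↑ʳ i) ≡ true)

data FromCrossByEdgeSubdiv (n : ℕ) : (V : Set) → Complex V → Set₁ where
  base : FromCrossByEdgeSubdiv n (Fin (n + n)) (crossPolytope n)
  step : {V : Set} {Δ : Complex V} → FromCrossByEdgeSubdiv n V Δ →
         (f : Face V) → IsEdge Δ f →
         FromCrossByEdgeSubdiv n (Maybe V) (stellar Δ f)

_≅_ : {V W : Set} → Complex V → Complex W → Set
_≅_ {V} {W} Δ₁ Δ₂ = Σ (V ⤖ W) λ σ →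
  ∀ (G : Face W) → Δ₂ G ⇔ Δ₁ (G ∘ Bijection.to σ)

-- Simplicial associahedron: vertices are diagonals of a convex (n+3)-gon
-- with vertices labelled 0 … n+2 cyclically; a diagonal (a,b) has
-- a + 2 ≤ b ≤ n+2 and is not the side (0, n+2).

record Diag (n : ℕ) : Set where
  constructor diag
  field
    a b      : ℕ
    nonadj   : suc (suc a) ≤ b
    bound    : b < n + 3
    notSide  : T (not ((a ≡ᵇ 0) ∧ (b ≡ᵇ (n + 2))))

Crosses : {n : ℕ} → Diag n → Diag n → Set
Crosses d₁ d₂ =
    (a₁ < a₂ × a₂ < b₁ × b₁ < b₂) ⊎ (a₂ < a₁ × a₁ < b₂ × b₂ < b₁)
  where open Diag d₁ renaming (a to a₁; b to b₁)
        open Diag d₂ renaming (a to a₂; b to b₂)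

associahedron : (n : ℕ) → Complex (Diag n)
associahedron n F = ∀ d e → F d ≡ true → F e ≡ true → ¬ Crosses d e

-- The 2n vertices ±eᵢ of the cross-polytope are labelled by the fan diagonals (0,i+2) and the
-- short diagonals (i+1,i+3) of the (n+3)-gon, so that antipodal pairs are exactly the crossing pairs
-- among them.  The remaining diagonals (a,b), 1 ≤ a, are then introduced in lexicographic order,
-- (a,m+2) by subdividing the edge {(a,m+1),(m,m+2)}.  Throughout, the complex is the flag complex on the
-- diagonals introduced so far in which two diagonals are adjacent unless they cross, the only
-- exception being a crossing pair (c,m+1),(m,m+2) whose resolving diagonal (c,m+2) is not yet there.
-- This invariant survives each step because stellar subdivision of an edge {u,v} of a flag complex is
-- the flag complex in which the new vertex is joined to the common neighbours of u and v and the edge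
-- {u,v} is removed.  Once every diagonal is present no crossing is left unresolved, which gives the
-- associahedron.

module Submission where

open import Defs
open import Level using (0ℓ)
open import Data.Nat using (ℕ; zero; suc; _+_; _≤_; _<_; z≤n; s≤s; _<?_; _≤′_; ≤′-refl; ≤′-step; _≡ᵇ_)
import Data.Nat.Properties as ℕₚ
open import Data.Bool using (true; false; T; not; _∨_; _∧_)
open import Data.Bool.Properties using (T-irrelevant)
open import Data.Fin using (Fin; toℕ; fromℕ<; splitAt; _↑ˡ_; _↑ʳ_)
import Data.Fin.Properties as Finₚ
open import Data.Maybe using (Maybe; just; nothing)
open import Data.Maybe.Properties using (≡-dec)
open import Data.Product using (Σ; ∃₂; _×_; _,_; proj₁; proj₂; swap; uncurry)
open import Data.Sum using (_⊎_; inj₁; inj₂; [_,_]′)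
import Data.Sum as ⊎
open import Data.Unit using (⊤; tt)
open import Data.Empty using (⊥-elim)
open import Function using (_∘_; id)
open import Function.Bundles using (_⤖_; _⇔_; mk⇔; mk⤖; Equivalence)
import Function.Properties.Equivalence as ⇔
open import Relation.Binary.Core using (Rel)
open import Relation.Binary.Definitions using (DecidableEquality; Symmetric; Reflexive; tri<; tri≈; tri>)
open import Relation.Binary.PropositionalEquality using (_≡_; _≢_; refl; sym; trans; cong; subst; subst₂)
open import Relation.Nullary using (¬_; Dec; yes; no)
open import Relation.Nullary.Decidable using (⌊_⌋; _×-dec_; _⊎-dec_)

Flag : {V : Set} → Rel V 0ℓ → Complex V
Flag R F = ∀ x y → F x ≡ true → F y ≡ true → R x y

IsFlagOf : {V : Set} → Complex V → Rel V 0ℓ → Set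
IsFlagOf Δ R = ∀ F → Δ F ⇔ Flag R F

Flag-cong : {V : Set} {R S : Rel V 0ℓ} → (∀ x y → R x y ⇔ S x y) → IsFlagOf (Flag R) S
Flag-cong R⇔S F = mk⇔ (λ c x y Fx Fy → Equivalence.to   (R⇔S x y) (c x y Fx Fy))
                      (λ c x y Fx Fy → Equivalence.from (R⇔S x y) (c x y Fx Fy))

IsPair : {V : Set} → Face V → V → V → Set
IsPair f u v = ∀ x → f x ≡ true ⇔ (x ≡ u ⊎ x ≡ v)

pair : {V : Set} → DecidableEquality V → V → V → Face V
pair _≟_ u v x = ⌊ x ≟ u ⌋ ∨ ⌊ x ≟ v ⌋

pair-isPair : {V : Set} (_≟_ : DecidableEquality V) (u v : V) → IsPair (pair _≟_ u v) u v
pair-isPair _≟_ u v x with x ≟ u | x ≟ v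
... | yes x≡u | _       = mk⇔ (λ _ → inj₁ x≡u) (λ _ → refl)
... | no _    | yes x≡v = mk⇔ (λ _ → inj₂ x≡v) (λ _ → refl)
... | no x≢u  | no x≢v  = mk⇔ (λ ()) (⊥-elim ∘ [ x≢u , x≢v ]′)

isTwoSet : {V : Set} {f : Face V} {u v : V} → IsPair f u v → u ≢ v → IsTwoSet f
isTwoSet {u = u} {v} f-pair u≢v =
  u , v , u≢v , λ x → Equivalence.to (f-pair x) , Equivalence.from (f-pair x)

module EdgeSubdivision {V : Set} {R : Rel V 0ℓ} (R-sym : Symmetric R) (R-refl : Reflexive R)
                       {u v : V} (Ruv : R u v) where

  Subdivided : Rel (Maybe V) 0ℓ
  Subdivided (just x) (just y) = R x y × ¬ (x ≡ u × y ≡ v) × ¬ (x ≡ v × y ≡ u)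
  Subdivided (just x) nothing  = R x u × R x v
  Subdivided nothing  (just y) = R y u × R y v
  Subdivided nothing  nothing  = ⊤

  R-on-pair : ∀ {x y} → x ≡ u ⊎ x ≡ v → y ≡ u ⊎ y ≡ v → R x y
  R-on-pair (inj₁ refl) (inj₁ refl) = R-refl
  R-on-pair (inj₁ refl) (inj₂ refl) = Ruv
  R-on-pair (inj₂ refl) (inj₁ refl) = R-sym Ruv
  R-on-pair (inj₂ refl) (inj₂ refl) = R-refl

  module _ {f : Face V} (f-pair : IsPair f u v) where

    private
      ∈f⇒ : ∀ {x} → f x ≡ true → x ≡ u ⊎ x ≡ v
      ∈f⇒ {x} = Equivalence.to (f-pair x)

      ⇒∈f : ∀ {x} → x ≡ u ⊎ x ≡ v → f x ≡ true
      ⇒∈f {x} = Equivalence.from (f-pair x)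

    pair-edge : ∀ {Δ} → IsFlagOf Δ R → Δ f
    pair-edge Δ-flag = Equivalence.from (Δ-flag f) λ x y fx fy → R-on-pair (∈f⇒ fx) (∈f⇒ fy)

    ⊆⇒∋pair : ∀ {H : Face V} → f ⊆ H → H u ≡ true × H v ≡ true
    ⊆⇒∋pair f⊆H = f⊆H u (⇒∈f (inj₁ refl)) , f⊆H v (⇒∈f (inj₂ refl))

    ∋pair⇒⊆ : ∀ {H : Face V} → H u ≡ true → H v ≡ true → f ⊆ H
    ∋pair⇒⊆ Hu Hv x fx with ∈f⇒ fx
    ... | inj₁ refl = Hu
    ... | inj₂ refl = Hv

    separated : ∀ (H : Face V) → ¬ f ⊆ H → ∀ {x y} → H x ≡ true → H y ≡ true → ¬ (x ≡ u × y ≡ v)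
    separated H f⊈H Hx Hy (refl , refl) = f⊈H (∋pair⇒⊆ Hx Hy)

    ∈∪f⇒ : ∀ (H : Face V) x → (H ∪ f) x ≡ true → H x ≡ true ⊎ (x ≡ u ⊎ x ≡ v)
    ∈∪f⇒ H x Hfx with H x
    ... | true  = inj₁ refl
    ... | false = inj₂ (∈f⇒ Hfx)

    ∈H⇒∈∪f : ∀ (H : Face V) {x} → H x ≡ true → (H ∪ f) x ≡ true
    ∈H⇒∈∪f H Hx rewrite Hx = refl

    ∈f⇒∈∪f : ∀ (H : Face V) {x} → f x ≡ true → (H ∪ f) x ≡ true
    ∈f⇒∈∪f H {x} fx with H x
    ... | true  = refl
    ... | false = fx

    stellar⇒flag : ∀ {Δ} → IsFlagOf Δ R → ∀ G → stellar Δ f G → Flag Subdivided G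
    stellar⇒flag Δ-flag G (inj₁ (G∌new , f⊈G , ΔG)) = go
      where
      R-clique : Flag R (G ∘ just)
      R-clique = Equivalence.to (Δ-flag (G ∘ just)) ΔG
      go : Flag Subdivided G
      go nothing  _        Gx _  with () ← trans (sym G∌new) Gx
      go (just x) nothing  _  Gy with () ← trans (sym G∌new) Gy
      go (just x) (just y) Gx Gy =
        R-clique x y Gx Gy , separated (G ∘ just) f⊈G Gx Gy , separated (G ∘ just) f⊈G Gy Gx ∘ swap
    stellar⇒flag Δ-flag G (inj₂ (_ , f⊈G , ΔG∪f)) = go
      where
      R-clique : Flag R ((G ∘ just) ∪ f)
      R-clique = Equivalence.to (Δ-flag ((G ∘ just) ∪ f)) ΔG∪f
      R-pair : ∀ {x} → G (just x) ≡ true → R x u × R x v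
      R-pair Gx = R-clique _ u (∈H⇒∈∪f (G ∘ just) Gx) (∈f⇒∈∪f (G ∘ just) (⇒∈f (inj₁ refl)))
                , R-clique _ v (∈H⇒∈∪f (G ∘ just) Gx) (∈f⇒∈∪f (G ∘ just) (⇒∈f (inj₂ refl)))
      go : Flag Subdivided G
      go nothing  nothing  _  _  = tt
      go nothing  (just y) _  Gy = R-pair Gy
      go (just x) nothing  Gx _  = R-pair Gx
      go (just x) (just y) Gx Gy = R-clique x y (∈H⇒∈∪f (G ∘ just) Gx) (∈H⇒∈∪f (G ∘ just) Gy)
                                 , separated (G ∘ just) f⊈G Gx Gy , separated (G ∘ just) f⊈G Gy Gx ∘ swap

    flag⇒⊈ : ∀ {G} → Flag Subdivided G → ¬ f ⊆ (G ∘ just)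
    flag⇒⊈ clique f⊆G =
      proj₁ (proj₂ (clique (just u) (just v) (proj₁ (⊆⇒∋pair f⊆G)) (proj₂ (⊆⇒∋pair f⊆G)))) (refl , refl)

    flag⇒stellar : ∀ {Δ} → IsFlagOf Δ R → ∀ G → Flag Subdivided G → stellar Δ f G
    flag⇒stellar Δ-flag G clique with G nothing in G∋new
    ... | false = inj₁ (refl , flag⇒⊈ clique , Equivalence.from (Δ-flag (G ∘ just))
                         λ x y Gx Gy → proj₁ (clique (just x) (just y) Gx Gy))
    ... | true = inj₂ (refl , flag⇒⊈ clique , Equivalence.from (Δ-flag ((G ∘ just) ∪ f)) go)
      where
      R-pair : ∀ {x y} → G (just x) ≡ true → y ≡ u ⊎ y ≡ v → R x y
      R-pair Gx (inj₁ refl) = proj₁ (clique (just _) nothing Gx G∋new)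
      R-pair Gx (inj₂ refl) = proj₂ (clique (just _) nothing Gx G∋new)
      go : Flag R ((G ∘ just) ∪ f)
      go x y Gfx Gfy with ∈∪f⇒ (G ∘ just) x Gfx | ∈∪f⇒ (G ∘ just) y Gfy
      ... | inj₁ Gx  | inj₁ Gy  = proj₁ (clique (just x) (just y) Gx Gy)
      ... | inj₁ Gx  | inj₂ y∈f = R-pair Gx y∈f
      ... | inj₂ x∈f | inj₁ Gy  = R-sym (R-pair Gy x∈f)
      ... | inj₂ x∈f | inj₂ y∈f = R-on-pair x∈f y∈f

    stellar-flag : ∀ {Δ} → IsFlagOf Δ R → IsFlagOf (stellar Δ f) Subdivided
    stellar-flag Δ-flag G = mk⇔ (stellar⇒flag Δ-flag G) (flag⇒stellar Δ-flag G)

Cross : ℕ → ℕ → ℕ → ℕ → Set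
Cross a₁ b₁ a₂ b₂ = (a₁ < a₂ × a₂ < b₁ × b₁ < b₂) ⊎ (a₂ < a₁ × a₁ < b₂ × b₂ < b₁)

cross? : ∀ a₁ b₁ a₂ b₂ → Dec (Cross a₁ b₁ a₂ b₂)
cross? a₁ b₁ a₂ b₂ = (a₁ <? a₂ ×-dec a₂ <? b₁ ×-dec b₁ <? b₂)
                ⊎-dec (a₂ <? a₁ ×-dec a₁ <? b₂ ×-dec b₂ <? b₁)

Cross-sym : ∀ {a₁ b₁ a₂ b₂} → Cross a₁ b₁ a₂ b₂ → Cross a₂ b₂ a₁ b₁
Cross-sym (inj₁ c) = inj₂ c
Cross-sym (inj₂ c) = inj₁ c

¬Cross-common-start : ∀ {a b₁ b₂} → ¬ Cross a b₁ a b₂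
¬Cross-common-start {a} (inj₁ (a<a , _)) = ℕₚ.n≮n a a<a
¬Cross-common-start {a} (inj₂ (a<a , _)) = ℕₚ.n≮n a a<a

Pred₂ : Set₁
Pred₂ = ℕ → ℕ → Set

-- (a₁,b₁) = (c,m+1) and (a₂,b₂) = (m,m+2): subdividing this edge introduces (c,m+2).
CrossAt : ℕ → ℕ → ℕ → ℕ → ℕ → ℕ → Set
CrossAt c m a₁ b₁ a₂ b₂ = a₁ ≡ c × b₁ ≡ suc m × a₂ ≡ m × b₂ ≡ suc (suc m)

UnresolvedCross : Pred₂ → ℕ → ℕ → ℕ → ℕ → Set
UnresolvedCross P a₁ b₁ a₂ b₂ =
  ∃₂ λ c m → ¬ P c (suc (suc m)) × (CrossAt c m a₁ b₁ a₂ b₂ ⊎ CrossAt c m a₂ b₂ a₁ b₁)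

Compatible : Pred₂ → ℕ → ℕ → ℕ → ℕ → Set
Compatible P a₁ b₁ a₂ b₂ = ¬ Cross a₁ b₁ a₂ b₂ ⊎ UnresolvedCross P a₁ b₁ a₂ b₂

Compatible-sym : ∀ {P a₁ b₁ a₂ b₂} → Compatible P a₁ b₁ a₂ b₂ → Compatible P a₂ b₂ a₁ b₁
Compatible-sym (inj₁ ¬cross)                 = inj₁ (¬cross ∘ Cross-sym)
Compatible-sym (inj₂ (c , m , ¬P , inj₁ at)) = inj₂ (c , m , ¬P , inj₂ at)
Compatible-sym (inj₂ (c , m , ¬P , inj₂ at)) = inj₂ (c , m , ¬P , inj₁ at)

Compatible-refl : ∀ {P a b} → Compatible P a b a b
Compatible-refl = inj₁ ¬Cross-common-start

-- The diagonals present once (a₀,b₀) is the next one to be introduced: all short diagonals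
-- (c,c+2), and the others in lexicographic order.
Present : ℕ → ℕ → Pred₂
Present a₀ b₀ c e = c < a₀ ⊎ (c ≡ a₀ × e < b₀) ⊎ e ≡ suc (suc c)

Present-suc : ∀ {a₀ b₀ c e} → Present a₀ b₀ c e → Present a₀ (suc b₀) c e
Present-suc (inj₁ c<a₀)             = inj₁ c<a₀
Present-suc (inj₂ (inj₁ (c≡ , e<))) = inj₂ (inj₁ (c≡ , ℕₚ.m<n⇒m<1+n e<))
Present-suc (inj₂ (inj₂ short))     = inj₂ (inj₂ short)

Present-suc⁻ : ∀ {a₀ b₀ c e} → Present a₀ (suc b₀) c e → Present a₀ b₀ c e ⊎ (c ≡ a₀ × e ≡ b₀)
Present-suc⁻ (inj₁ c<a₀) = inj₁ (inj₁ c<a₀)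
Present-suc⁻ (inj₂ (inj₁ (c≡ , e<))) with ℕₚ.m<1+n⇒m<n∨m≡n e<
... | inj₁ e<b₀ = inj₁ (inj₂ (inj₁ (c≡ , e<b₀)))
... | inj₂ e≡b₀ = inj₂ (c≡ , e≡b₀)
Present-suc⁻ (inj₂ (inj₂ short)) = inj₁ (inj₂ (inj₂ short))

Present-beyond : ∀ {a₀ b₀ c e} → Present a₀ b₀ c e → a₀ < c → e ≡ suc (suc c)
Present-beyond (inj₁ c<a₀)            a₀<c = ⊥-elim (ℕₚ.<-asym c<a₀ a₀<c)
Present-beyond (inj₂ (inj₁ (refl , _))) a₀<c = ⊥-elim (ℕₚ.n≮n _ a₀<c)
Present-beyond (inj₂ (inj₂ short))    _    = short

CrossAt-unique : ∀ {c m c′ m′ a₁ b₁ a₂ b₂} → CrossAt c m a₁ b₁ a₂ b₂ → CrossAt c′ m′ a₁ b₁ a₂ b₂ →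
                 c ≡ c′ × m ≡ m′
CrossAt-unique (refl , refl , refl , refl) (refl , refl , refl , refl) = refl , refl

CrossAt-asym : ∀ {c m c′ m′ a₁ b₁ a₂ b₂} → CrossAt c m a₁ b₁ a₂ b₂ → ¬ CrossAt c′ m′ a₂ b₂ a₁ b₁
CrossAt-asym (refl , refl , refl , refl) (refl , () , refl , refl)

¬Cross-at-endpoint : ∀ {a₁ b₁ a₂} → ¬ Cross a₁ b₁ a₂ a₁
¬Cross-at-endpoint (inj₁ (a₁<a₂ , a₂<b₁ , b₁<a₁)) = ℕₚ.n≮n _ (ℕₚ.<-trans a₁<a₂ (ℕₚ.<-trans a₂<b₁ b₁<a₁))
¬Cross-at-endpoint (inj₂ (_ , a₁<a₁ , _))         = ℕₚ.n≮n _ a₁<a₁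

Compatible⇒unresolved : ∀ {P a₁ b₁ a₂ b₂} → Compatible P a₁ b₁ a₂ b₂ → Cross a₁ b₁ a₂ b₂ →
                        UnresolvedCross P a₁ b₁ a₂ b₂
Compatible⇒unresolved (inj₁ ¬cross)    cross = ⊥-elim (¬cross cross)
Compatible⇒unresolved (inj₂ unresolved) _    = unresolved

-- Introducing (a,m+2) by subdividing the edge between u = (a,m+1) and v = (m,m+2) leads from
-- stage P to stage P′.
module Introduction (a m : ℕ) (a<m : a < m) where

  P P′ : Pred₂
  P  = Present a (2 + m)
  P′ = Present a (3 + m)

  new-absent : ¬ P a (2 + m)
  new-absent (inj₁ a<a)              = ℕₚ.n≮n a a<a
  new-absent (inj₂ (inj₁ (_ , m<m))) = ℕₚ.n≮n _ m<m
  new-absent (inj₂ (inj₂ refl))      = ℕₚ.n≮n a a<m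

  new-present : P′ a (2 + m)
  new-present = inj₂ (inj₁ (refl , ℕₚ.n<1+n _))

  next-absent : ¬ P′ a (3 + m)
  next-absent (inj₁ a<a)              = ℕₚ.n≮n a a<a
  next-absent (inj₂ (inj₁ (_ , m<m))) = ℕₚ.n≮n _ m<m
  next-absent (inj₂ (inj₂ refl))      = ℕₚ.n≮n m (ℕₚ.<-trans (ℕₚ.n<1+n m) a<m)

  uv-cross : Cross a (suc m) m (2 + m)
  uv-cross = inj₁ (a<m , ℕₚ.n<1+n m , ℕₚ.n<1+n (suc m))

  uv-unresolved : UnresolvedCross P a (suc m) m (2 + m)
  uv-unresolved = a , m , new-absent , inj₁ (refl , refl , refl , refl)

  ¬CrossAt-new : ∀ {c′ m′ c e} → ¬ CrossAt c′ m′ c e a (2 + m)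
  ¬CrossAt-new (_ , _ , refl , refl) = ℕₚ.n≮n _ a<m

  unresolved′-not-uv : ∀ {a₁ b₁ a₂ b₂} → UnresolvedCross P′ a₁ b₁ a₂ b₂ → ¬ CrossAt a m a₁ b₁ a₂ b₂
  unresolved′-not-uv (_ , _ , ¬P′ , inj₁ at) uv with CrossAt-unique at uv
  ... | refl , refl = ¬P′ new-present
  unresolved′-not-uv (_ , _ , _   , inj₂ at) uv = CrossAt-asym uv at

  unresolved-with-new : ∀ {c e} → UnresolvedCross P′ a (2 + m) c e → c ≡ suc m × e ≡ 3 + m
  unresolved-with-new (_ , _ , _ , inj₁ (refl , refl , refl , refl)) = refl , refl
  unresolved-with-new (_ , _ , _ , inj₂ at) = ⊥-elim (¬CrossAt-new at)

  compatible-old⇒ : ∀ {a₁ b₁ a₂ b₂} → Compatible P′ a₁ b₁ a₂ b₂ →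
                    Compatible P a₁ b₁ a₂ b₂ × ¬ CrossAt a m a₁ b₁ a₂ b₂ × ¬ CrossAt a m a₂ b₂ a₁ b₁
  compatible-old⇒ (inj₁ ¬cross) =
    inj₁ ¬cross , (λ { (refl , refl , refl , refl) → ¬cross uv-cross })
                , (λ { (refl , refl , refl , refl) → ¬cross (Cross-sym uv-cross) })
  compatible-old⇒ (inj₂ (c , m′ , ¬P′ , at)) =
    inj₂ (c , m′ , ¬P′ ∘ Present-suc , at) ,
    unresolved′-not-uv (c , m′ , ¬P′ , at) ,
    unresolved′-not-uv (c , m′ , ¬P′ , ⊎.swap at)

  compatible-old⇐ : ∀ {a₁ b₁ a₂ b₂} → Compatible P a₁ b₁ a₂ b₂ →
                    ¬ CrossAt a m a₁ b₁ a₂ b₂ → ¬ CrossAt a m a₂ b₂ a₁ b₁ → Compatible P′ a₁ b₁ a₂ b₂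
  compatible-old⇐ (inj₁ ¬cross) _ _ = inj₁ ¬cross
  compatible-old⇐ {a₁} {b₁} {a₂} {b₂} (inj₂ (c , m′ , ¬P , at)) ¬uv ¬vu = inj₂ (c , m′ , ¬P′ at , at)
    where
    ¬P′ : CrossAt c m′ a₁ b₁ a₂ b₂ ⊎ CrossAt c m′ a₂ b₂ a₁ b₁ → ¬ P′ c (2 + m′)
    ¬P′ _ P′c with Present-suc⁻ P′c
    ¬P′ _         _ | inj₁ Pc            = ¬P Pc
    ¬P′ (inj₁ uv) _ | inj₂ (refl , refl) = ¬uv uv
    ¬P′ (inj₂ vu) _ | inj₂ (refl , refl) = ¬vu vu

  compatible-new⇒ᵘ : ∀ {c e} → P c e → Compatible P′ a (2 + m) c e → Compatible P c e a (suc m)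
  compatible-new⇒ᵘ _ (inj₂ unresolved) with unresolved-with-new unresolved
  ... | refl , refl = inj₁ ¬Cross-at-endpoint
  compatible-new⇒ᵘ {c} {e} Pce (inj₁ ¬cross) with cross? c e a (suc m)
  ... | no ¬cross′ = inj₁ ¬cross′
  ... | yes (inj₁ (c<a , a<e , e<1+m)) = ⊥-elim (¬cross (inj₂ (c<a , a<e , ℕₚ.m<n⇒m<1+n e<1+m)))
  ... | yes (inj₂ (a<c , c<1+m , 1+m<e)) with ℕₚ.m≤n⇒m<n∨m≡n 1+m<e
  ...   | inj₁ 2+m<e = ⊥-elim (¬cross (inj₁ (a<c , ℕₚ.m<n⇒m<1+n c<1+m , 2+m<e)))
  ...   | inj₂ refl with Present-beyond Pce a<c
  ...     | refl = Compatible-sym {P} (inj₂ uv-unresolved)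

  compatible-new⇒ᵛ : ∀ {c e} → P c e → Compatible P′ a (2 + m) c e → Compatible P c e m (2 + m)
  compatible-new⇒ᵛ _ (inj₂ unresolved) with unresolved-with-new unresolved
  ... | refl , refl = inj₂ (m , suc m , ¬P-m-3+m , inj₂ (refl , refl , refl , refl))
    where
    ¬P-m-3+m : ¬ P m (3 + m)
    ¬P-m-3+m Pm with Present-beyond Pm a<m
    ... | ()
  compatible-new⇒ᵛ {c} {e} Pce (inj₁ ¬cross) with cross? c e m (2 + m)
  ... | no ¬cross′ = inj₁ ¬cross′
  ... | yes (inj₂ (m<c , c<2+m , 2+m<e)) = ⊥-elim (¬cross (inj₁ (ℕₚ.<-trans a<m m<c , c<2+m , 2+m<e)))
  ... | yes (inj₁ (c<m , m<e , e<2+m)) with ℕₚ.≤-antisym (ℕₚ.≤-pred e<2+m) m<e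
  ...   | refl with ℕₚ.<-cmp c a
  ...     | tri< c<a _ _ = ⊥-elim (¬cross (inj₂ (c<a , ℕₚ.<-trans a<m m<e , e<2+m)))
  ...     | tri≈ _ refl _ = inj₂ uv-unresolved
  ...     | tri> _ _ a<c with Present-beyond Pce a<c
  ...       | refl = inj₂ (c , m , ¬P-c-2+m , inj₁ (refl , refl , refl , refl))
    where
    ¬P-c-2+m : ¬ P c (2 + m)
    ¬P-c-2+m Pc with Present-beyond Pc a<c
    ... | ()

  compatible-new⇐ : ∀ {c e} → Compatible P c e a (suc m) → Compatible P c e m (2 + m) →
                    Compatible P′ a (2 + m) c e
  compatible-new⇐ {c} {e} x∼u x∼v with cross? a (2 + m) c e
  ... | no ¬cross = inj₁ ¬cross
  ... | yes (inj₁ (a<c , c<2+m , 2+m<e)) with ℕₚ.m<1+n⇒m<n∨m≡n c<2+m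
  ...   | inj₁ c<1+m with Compatible⇒unresolved {P} x∼u (inj₂ (a<c , c<1+m , ℕₚ.<-trans (ℕₚ.n<1+n _) 2+m<e))
  ...     | _ , _ , _ , inj₁ (refl , refl , refl , refl) =
              ⊥-elim (ℕₚ.n≮n _ (ℕₚ.<-trans (ℕₚ.n<1+n _) (ℕₚ.<-trans (ℕₚ.n<1+n _) 2+m<e)))
  ...     | _ , _ , _ , inj₂ (refl , refl , refl , refl) = ⊥-elim (ℕₚ.n≮n _ 2+m<e)
  compatible-new⇐ {c} {e} x∼u x∼v | yes (inj₁ (a<c , c<2+m , 2+m<e)) | inj₂ refl
    with Compatible⇒unresolved {P} x∼v (inj₂ (ℕₚ.n<1+n m , ℕₚ.n<1+n _ , 2+m<e))
  ...   | _ , _ , _ , inj₁ (refl , refl , refl , refl) = ⊥-elim (ℕₚ.n≮n _ (ℕₚ.<-trans (ℕₚ.n<1+n _) 2+m<e))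
  ...   | _ , _ , _ , inj₂ (refl , refl , refl , refl) =
          inj₂ (a , suc m , next-absent , inj₁ (refl , refl , refl , refl))
  compatible-new⇐ {c} {e} x∼u x∼v | yes (inj₂ (c<a , a<e , e<2+m)) with ℕₚ.m<1+n⇒m<n∨m≡n e<2+m
  ...   | inj₁ e<1+m with Compatible⇒unresolved {P} x∼u (inj₁ (c<a , a<e , e<1+m))
  ...     | _ , _ , ¬P , inj₁ (refl , refl , refl , refl) = ⊥-elim (¬P (inj₁ c<a))
  ...     | _ , _ , _  , inj₂ (refl , refl , refl , refl) = ⊥-elim (ℕₚ.<-asym c<a a<m)
  compatible-new⇐ {c} {e} x∼u x∼v | yes (inj₂ (c<a , a<e , e<2+m)) | inj₂ refl
    with Compatible⇒unresolved {P} x∼v (inj₁ (ℕₚ.<-trans c<a a<m , ℕₚ.n<1+n m , ℕₚ.n<1+n _))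
  ...   | _ , _ , ¬P , inj₁ (refl , refl , refl , refl) = ⊥-elim (¬P (inj₁ c<a))
  ...   | _ , _ , _  , inj₂ (refl , refl , refl , ())

Diag-≡ : ∀ {n} {d d′ : Diag n} → Diag.a d ≡ Diag.a d′ → Diag.b d ≡ Diag.b d′ → d ≡ d′
Diag-≡ {d = diag _ _ p q r} {diag _ _ p′ q′ r′} refl refl
  with ℕₚ.≤-irrelevant p p′ | ℕₚ.≤-irrelevant q q′ | T-irrelevant r r′
... | refl | refl | refl = refl

3+-≤-+3 : ∀ {k n} → k ≤ n → 3 + k ≤ n + 3
3+-≤-+3 {k} {n} k≤n = subst (3 + k ≤_) (ℕₚ.+-comm 3 n) (s≤s (s≤s (s≤s k≤n)))

3+-≤-+3⁻ : ∀ {k n} → 3 + k ≤ n + 3 → k ≤ n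
3+-≤-+3⁻ {k} {n} 3+k≤n+3 = ℕₚ.≤-pred (ℕₚ.≤-pred (ℕₚ.≤-pred (subst (3 + k ≤_) (ℕₚ.+-comm n 3) 3+k≤n+3)))

≢⇒T-not-≡ᵇ : ∀ {m k} → m ≢ k → T (not (m ≡ᵇ k))
≢⇒T-not-≡ᵇ {m} {k} m≢k with m ≡ᵇ k | ℕₚ.≡ᵇ⇒≡ m k
... | true  | ≡ᵇ⇒≡ = m≢k (≡ᵇ⇒≡ tt)
... | false | _    = tt

T-not-≡ᵇ⇒≢ : ∀ {m k} → T (not (m ≡ᵇ k)) → m ≢ k
T-not-≡ᵇ⇒≢ {m} {k} t m≡k with m ≡ᵇ k | ℕₚ.≡⇒≡ᵇ m k m≡k
... | true  | _ = t

module Construction (n : ℕ) where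
  open Diag

  _∋ᵈ_ : Pred₂ → Diag n → Set
  P ∋ᵈ d = P (a d) (b d)

  Compatibleᵈ : Pred₂ → Diag n → Diag n → Set
  Compatibleᵈ P x y = Compatible P (a x) (b x) (a y) (b y)

  CompatibleVia : {V : Set} → (V → Diag n) → Pred₂ → Rel V 0ℓ
  CompatibleVia label P x y = Compatibleᵈ P (label x) (label y)

  record Stage (P : Pred₂) : Set₁ where
    field
      V               : Set
      Δ               : Complex V
      history         : FromCrossByEdgeSubdiv n V Δ
      _≟ᵥ_            : DecidableEquality V
      label           : V → Diag n
      label-injective : ∀ {x y} → label x ≡ label y → x ≡ y
      label-present   : ∀ x → P ∋ᵈ label x
      label-onto      : ∀ d → P ∋ᵈ d → Σ V λ x → label x ≡ d
      flag            : IsFlagOf Δ (CompatibleVia label P)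

  notSide-pos : ∀ {c} e → 1 ≤ c → T (not ((c ≡ᵇ 0) ∧ (e ≡ᵇ (n + 2))))
  notSide-pos _ (s≤s z≤n) = tt

  innerDiag : ∀ {c e} → 1 ≤ c → 2 + c ≤ e → e < n + 3 → Diag n
  innerDiag {c} {e} 1≤c c+2≤e e<n+3 = diag c e c+2≤e e<n+3 (notSide-pos e 1≤c)

  module AddDiagonal {r m : ℕ} (1≤r : 1 ≤ r) (r<m : r < m) (m+2<n+3 : 2 + m < n + 3)
                     (S : Stage (Present r (2 + m))) where
    open Stage S
    open Introduction r m r<m

    new u v : Diag n
    new = innerDiag 1≤r (s≤s (s≤s (ℕₚ.<⇒≤ r<m))) m+2<n+3
    u   = innerDiag 1≤r (s≤s r<m) (ℕₚ.<-trans (ℕₚ.n<1+n _) m+2<n+3)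
    v   = innerDiag (ℕₚ.≤-trans 1≤r (ℕₚ.<⇒≤ r<m)) ℕₚ.≤-refl m+2<n+3

    uₛ vₛ : V
    uₛ = proj₁ (label-onto u (inj₂ (inj₁ (refl , ℕₚ.n<1+n _))))
    vₛ = proj₁ (label-onto v (inj₂ (inj₂ refl)))

    uₛ-label : label uₛ ≡ u
    uₛ-label = proj₂ (label-onto u _)
    vₛ-label : label vₛ ≡ v
    vₛ-label = proj₂ (label-onto v _)

    R : Rel V 0ℓ
    R = CompatibleVia label P

    Ruv : R uₛ vₛ
    Ruv = subst₂ (Compatibleᵈ P) (sym uₛ-label) (sym vₛ-label) (inj₂ uv-unresolved)

    uₛ≢vₛ : uₛ ≢ vₛ
    uₛ≢vₛ uₛ≡vₛ = ℕₚ.<⇒≢ r<m (cong a (trans (sym uₛ-label) (trans (cong label uₛ≡vₛ) vₛ-label)))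

    open EdgeSubdivision {R = R} (Compatible-sym {P}) (Compatible-refl {P}) Ruv

    edge : Face V
    edge = pair _≟ᵥ_ uₛ vₛ

    edge-pair : IsPair edge uₛ vₛ
    edge-pair = pair-isPair _≟ᵥ_ uₛ vₛ

    label′ : Maybe V → Diag n
    label′ nothing  = new
    label′ (just x) = label x

    label′-injective : ∀ {x y} → label′ x ≡ label′ y → x ≡ y
    label′-injective {nothing} {nothing} _ = refl
    label′-injective {just x}  {just y}  lx≡ly = cong just (label-injective lx≡ly)
    label′-injective {nothing} {just y}  new≡ly =
      ⊥-elim (new-absent (subst (P ∋ᵈ_) (sym new≡ly) (label-present y)))
    label′-injective {just x}  {nothing} lx≡new =
      ⊥-elim (new-absent (subst (P ∋ᵈ_) lx≡new (label-present x)))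

    label′-present : ∀ x → P′ ∋ᵈ label′ x
    label′-present nothing  = new-present
    label′-present (just x) = Present-suc (label-present x)

    label′-onto : ∀ d → P′ ∋ᵈ d → Σ (Maybe V) λ x → label′ x ≡ d
    label′-onto d P′d with Present-suc⁻ P′d
    ... | inj₁ Pd = just (proj₁ (label-onto d Pd)) , proj₂ (label-onto d Pd)
    ... | inj₂ (a≡r , b≡m+2) = nothing , Diag-≡ (sym a≡r) (sym b≡m+2)

    crossAt⇔ : ∀ x y → CrossAt r m (a (label x)) (b (label x)) (a (label y)) (b (label y)) ⇔
                       (x ≡ uₛ × y ≡ vₛ)
    crossAt⇔ x y = mk⇔
      (λ (p , q , p′ , q′) → label-injective (trans (Diag-≡ p q) (sym uₛ-label))
                           , label-injective (trans (Diag-≡ p′ q′) (sym vₛ-label)))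
      (λ { (refl , refl) → cong a uₛ-label , cong b uₛ-label , cong a vₛ-label , cong b vₛ-label })

    R-at : ∀ {y z d} → label z ≡ d → R y z ⇔ Compatibleᵈ P (label y) d
    R-at refl = mk⇔ id id

    new-compatible⇔ : ∀ y → (R y uₛ × R y vₛ) ⇔ Compatibleᵈ P′ new (label y)
    new-compatible⇔ y = mk⇔
      (λ (yu , yv) → compatible-new⇐ (Equivalence.to (R-at uₛ-label) yu) (Equivalence.to (R-at vₛ-label) yv))
      (λ new∼y → Equivalence.from (R-at uₛ-label) (compatible-new⇒ᵘ (label-present y) new∼y)
               , Equivalence.from (R-at vₛ-label) (compatible-new⇒ᵛ (label-present y) new∼y))

    compatible′ : ∀ p q → Subdivided p q ⇔ Compatibleᵈ P′ (label′ p) (label′ q)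
    compatible′ nothing  nothing  = mk⇔ (λ _ → Compatible-refl {P′}) (λ _ → tt)
    compatible′ nothing  (just y) = new-compatible⇔ y
    compatible′ (just x) nothing  =
      ⇔.trans (new-compatible⇔ x) (mk⇔ (Compatible-sym {P′}) (Compatible-sym {P′}))
    compatible′ (just x) (just y) = mk⇔
      (λ (x∼y , ¬uv , ¬vu) → compatible-old⇐ x∼y (¬uv ∘ Equivalence.to (crossAt⇔ x y))
                                                   (¬vu ∘ swap ∘ Equivalence.to (crossAt⇔ y x)))
      (λ x∼′y → let (x∼y , ¬uv , ¬vu) = compatible-old⇒ x∼′y in
                x∼y , ¬uv ∘ Equivalence.from (crossAt⇔ x y) , ¬vu ∘ Equivalence.from (crossAt⇔ y x) ∘ swap)

    stage : Stage P′
    stage = record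
      { V               = Maybe V
      ; Δ               = stellar Δ edge
      ; history         = step history edge (pair-edge edge-pair flag , isTwoSet edge-pair uₛ≢vₛ)
      ; _≟ᵥ_            = ≡-dec _≟ᵥ_
      ; label           = label′
      ; label-injective = label′-injective
      ; label-present   = label′-present
      ; label-onto      = label′-onto
      ; flag            = λ G → ⇔.trans (stellar-flag edge-pair flag G) (Flag-cong compatible′ G)
      }

  addDiagonal : ∀ {r b} → 1 ≤ r → 2 + r < b → b < n + 3 → Stage (Present r b) → Stage (Present r (suc b))
  addDiagonal {b = suc (suc m)} 1≤r (s≤s (s≤s r<m)) b<n+3 = AddDiagonal.stage 1≤r r<m b<n+3

  _≈ᴾ_ : Pred₂ → Pred₂ → Set
  P ≈ᴾ Q = ∀ c e → 2 + c ≤ e → e < n + 3 → P c e ⇔ Q c e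

  resolvent-valid : ∀ (x y : Diag n) {c m} →
                    CrossAt c m (a x) (b x) (a y) (b y) ⊎ CrossAt c m (a y) (b y) (a x) (b x) →
                    2 + c ≤ 2 + m × 2 + m < n + 3
  resolvent-valid x y = [ valid x y , valid y x ]′
    where
    valid : ∀ (x y : Diag n) {c m} → CrossAt c m (a x) (b x) (a y) (b y) → 2 + c ≤ 2 + m × 2 + m < n + 3
    valid x y (refl , b≡ , _ , b′≡) =
      ℕₚ.m≤n⇒m≤1+n (subst (2 + a x ≤_) b≡ (nonadj x)) , subst (_< n + 3) b′≡ (bound y)

  Compatibleᵈ-transport : ∀ {P Q} → (∀ c e → 2 + c ≤ e → e < n + 3 → Q c e → P c e) →
                          ∀ x y → Compatibleᵈ P x y → Compatibleᵈ Q x y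
  Compatibleᵈ-transport _   _ _ (inj₁ ¬cross) = inj₁ ¬cross
  Compatibleᵈ-transport Q⇒P x y (inj₂ (c , m , ¬P , at)) =
    inj₂ (c , m , ¬P ∘ uncurry (Q⇒P c _) (resolvent-valid x y at) , at)

  Stage-cong : ∀ {P Q} → P ≈ᴾ Q → Stage P → Stage Q
  Stage-cong {P} {Q} P≈Q S = record
    { V               = V
    ; Δ               = Δ
    ; history         = history
    ; _≟ᵥ_            = _≟ᵥ_
    ; label           = label
    ; label-injective = label-injective
    ; label-present   = λ x → Equivalence.to (≈ (label x)) (label-present x)
    ; label-onto      = λ d Qd → label-onto d (Equivalence.from (≈ d) Qd)
    ; flag            = λ F → ⇔.trans (flag F) (Flag-cong compatible⇔ F)
    }
    where
    open Stage S
    compatible⇔ : ∀ x y → CompatibleVia label P x y ⇔ CompatibleVia label Q x y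
    compatible⇔ x y = mk⇔
      (Compatibleᵈ-transport (λ c e p q → Equivalence.from (P≈Q c e p q)) (label x) (label y))
      (Compatibleᵈ-transport (λ c e p q → Equivalence.to   (P≈Q c e p q)) (label x) (label y))
    ≈ : ∀ d → P ∋ᵈ d ⇔ Q ∋ᵈ d
    ≈ d = P≈Q (a d) (b d) (nonadj d) (bound d)

  completed-row≈next-row : ∀ r → Present (suc r) (n + 3) ≈ᴾ Present (2 + r) (5 + r)
  completed-row≈next-row r c e c+2≤e e<n+3 = mk⇔ to from
    where
    to : Present (suc r) (n + 3) c e → Present (2 + r) (5 + r) c e
    to (inj₁ c<1+r)             = inj₁ (ℕₚ.m<n⇒m<1+n c<1+r)
    to (inj₂ (inj₁ (refl , _))) = inj₁ (ℕₚ.n<1+n _)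
    to (inj₂ (inj₂ short))      = inj₂ (inj₂ short)
    from : Present (2 + r) (5 + r) c e → Present (suc r) (n + 3) c e
    from (inj₁ c<2+r) with ℕₚ.m<1+n⇒m<n∨m≡n c<2+r
    ... | inj₁ c<1+r = inj₁ c<1+r
    ... | inj₂ c≡1+r = inj₂ (inj₁ (c≡1+r , e<n+3))
    from (inj₂ (inj₁ (refl , e<5+r))) = inj₂ (inj₂ (ℕₚ.≤-antisym (ℕₚ.≤-pred e<5+r) c+2≤e))
    from (inj₂ (inj₂ short))          = inj₂ (inj₂ short)

  fillRow : ∀ {r b c} → 1 ≤ r → 2 + r < b → b ≤′ c → c ≤ n + 3 → Stage (Present r b) → Stage (Present r c)
  fillRow _   _       ≤′-refl          _     S = S
  fillRow 1≤r r+2<b (≤′-step b≤′c) c≤n+3 S =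
    addDiagonal 1≤r (ℕₚ.<-≤-trans r+2<b (ℕₚ.≤′⇒≤ b≤′c)) c≤n+3
      (fillRow 1≤r r+2<b b≤′c (ℕₚ.<⇒≤ c≤n+3) S)

  -- The vertex +eᵢ is the fan diagonal (0,i+2), and -eᵢ is the short diagonal (i+1,i+3).
  fan short : Fin n → Diag n
  fan i = diag 0 (2 + toℕ i) (s≤s (s≤s z≤n)) (3+-≤-+3 (ℕₚ.<⇒≤ (Finₚ.toℕ<n i)))
            (≢⇒T-not-≡ᵇ λ 2+i≡n+2 →
               ℕₚ.<⇒≢ (Finₚ.toℕ<n i) (ℕₚ.+-cancelˡ-≡ 2 _ _ (trans 2+i≡n+2 (ℕₚ.+-comm n 2))))
  short i = innerDiag (s≤s z≤n) ℕₚ.≤-refl (3+-≤-+3 (Finₚ.toℕ<n i))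

  label₀ : Fin (n + n) → Diag n
  label₀ x = [ fan , short ]′ (splitAt n x)

  data CrossVertex : Fin (n + n) → ℕ → ℕ → Set where
    fanᵛ   : ∀ i → CrossVertex (i ↑ˡ n) 0 (2 + toℕ i)
    shortᵛ : ∀ i → CrossVertex (n ↑ʳ i) (1 + toℕ i) (3 + toℕ i)

  Initial : Pred₂
  Initial = Present 1 4

  crossVertex : ∀ x → CrossVertex x (a (label₀ x)) (b (label₀ x))
  crossVertex x with splitAt n x in eq
  ... | inj₁ i with refl ← Finₚ.splitAt⁻¹-↑ˡ eq = fanᵛ i
  ... | inj₂ i with refl ← Finₚ.splitAt⁻¹-↑ʳ eq = shortᵛ i

  label₀-fan : ∀ i → label₀ (i ↑ˡ n) ≡ fan i
  label₀-fan i = cong [ fan , short ]′ (Finₚ.splitAt-↑ˡ n i n)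

  label₀-short : ∀ i → label₀ (n ↑ʳ i) ≡ short i
  label₀-short i = cong [ fan , short ]′ (Finₚ.splitAt-↑ʳ n n i)

  label₀-injective : ∀ {x y} → label₀ x ≡ label₀ y → x ≡ y
  label₀-injective {x} {y} lx≡ly = go (crossVertex x) (crossVertex y) (cong a lx≡ly) (cong b lx≡ly)
    where
    go : ∀ {x y c e c′ e′} → CrossVertex x c e → CrossVertex y c′ e′ → c ≡ c′ → e ≡ e′ → x ≡ y
    go (fanᵛ i)   (fanᵛ j)   _    e≡e′ = cong (_↑ˡ n) (Finₚ.toℕ-injective (ℕₚ.+-cancelˡ-≡ 2 _ _ e≡e′))
    go (shortᵛ i) (shortᵛ j) c≡c′ _    = cong (n ↑ʳ_) (Finₚ.toℕ-injective (ℕₚ.suc-injective c≡c′))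

  label₀-present : ∀ x → Initial ∋ᵈ label₀ x
  label₀-present x = go (crossVertex x)
    where
    go : ∀ {x c e} → CrossVertex x c e → Initial c e
    go (fanᵛ _)   = inj₁ (s≤s z≤n)
    go (shortᵛ _) = inj₂ (inj₂ refl)

  Initial-short : ∀ {t e} → 3 + t ≤ e → Initial (suc t) e → e ≡ 3 + t
  Initial-short _   (inj₁ (s≤s ()))
  Initial-short 3≤e (inj₂ (inj₁ (refl , e<4))) = ℕₚ.≤-antisym (ℕₚ.≤-pred e<4) 3≤e
  Initial-short _   (inj₂ (inj₂ e≡t+3))        = e≡t+3

  label₀-onto : ∀ d → Initial ∋ᵈ d → Σ (Fin (n + n)) λ x → label₀ x ≡ d
  label₀-onto (diag 0 0 () _ _) _
  label₀-onto (diag 0 1 (s≤s ()) _ _) _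
  label₀-onto (diag 0 (suc (suc t)) _ t+2<n+3 notSide) _ =
    i ↑ˡ n , trans (label₀-fan i) (Diag-≡ refl (cong (2 +_) (Finₚ.toℕ-fromℕ< t<n)))
    where
    t≢n : t ≢ n
    t≢n refl = T-not-≡ᵇ⇒≢ notSide (ℕₚ.+-comm 2 t)
    t<n : t < n
    t<n = ℕₚ.≤∧≢⇒< (3+-≤-+3⁻ t+2<n+3) t≢n
    i : Fin n
    i = fromℕ< t<n
  label₀-onto (diag (suc t) e t+3≤e e<n+3 _) present with Initial-short t+3≤e present
  ... | refl = n ↑ʳ i , trans (label₀-short i) (Diag-≡ (cong suc toℕi≡t) (cong (3 +_) toℕi≡t))
    where
    t<n : t < n
    t<n = 3+-≤-+3⁻ e<n+3
    i : Fin n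
    i = fromℕ< t<n
    toℕi≡t : toℕ i ≡ t
    toℕi≡t = Finₚ.toℕ-fromℕ< t<n

  fan-short-cross : ∀ {i j : Fin n} → Cross 0 (2 + toℕ i) (1 + toℕ j) (3 + toℕ j) → j ≡ i
  fan-short-cross (inj₁ (_ , 1+j<2+i , 2+i<3+j)) = Finₚ.toℕ-injective
    (ℕₚ.≤-antisym (ℕₚ.≤-pred (ℕₚ.≤-pred 1+j<2+i)) (ℕₚ.≤-pred (ℕₚ.≤-pred (ℕₚ.≤-pred 2+i<3+j))))

  adjacent-shorts-unresolved : ∀ s → ¬ Initial (1 + s) (4 + s)
  adjacent-shorts-unresolved _ (inj₁ (s≤s ()))
  adjacent-shorts-unresolved _ (inj₂ (inj₁ (refl , s≤s (s≤s (s≤s (s≤s ()))))))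
  adjacent-shorts-unresolved _ (inj₂ (inj₂ ()))

  shorts-compatible : ∀ s t → Compatible Initial (1 + s) (3 + s) (1 + t) (3 + t)
  shorts-compatible s t with cross? (1 + s) (3 + s) (1 + t) (3 + t)
  ... | no ¬cross = inj₁ ¬cross
  ... | yes (inj₁ (1+s<1+t , 1+t<3+s , _))
    with ℕₚ.≤-antisym (ℕₚ.≤-pred (ℕₚ.≤-pred 1+t<3+s)) (ℕₚ.≤-pred 1+s<1+t)
  ...   | refl = inj₂ (1 + s , 2 + s , adjacent-shorts-unresolved s , inj₁ (refl , refl , refl , refl))
  shorts-compatible s t | yes (inj₂ (1+t<1+s , 1+s<3+t , _))
    with ℕₚ.≤-antisym (ℕₚ.≤-pred (ℕₚ.≤-pred 1+s<3+t)) (ℕₚ.≤-pred 1+t<1+s)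
  ...   | refl = inj₂ (1 + t , 2 + t , adjacent-shorts-unresolved t , inj₂ (refl , refl , refl , refl))

  antipodes-incompatible : ∀ t → ¬ Compatible Initial 0 (2 + t) (1 + t) (3 + t)
  antipodes-incompatible t (inj₁ ¬cross) = ¬cross (inj₁ (s≤s z≤n , ℕₚ.n<1+n _ , ℕₚ.n<1+n _))
  antipodes-incompatible t (inj₂ (_ , _ , ¬P , inj₁ (refl , refl , refl , refl))) = ¬P (inj₁ (s≤s z≤n))
  antipodes-incompatible t (inj₂ (_ , _ , _  , inj₂ (refl , refl , () , _)))

  flag₀ : IsFlagOf (crossPolytope n) (CompatibleVia label₀ Initial)
  flag₀ F = mk⇔ (λ noAntipodes x y Fx Fy → go noAntipodes (crossVertex x) (crossVertex y) Fx Fy)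
                antipodes-absent
    where
    go : ∀ {x y c e c′ e′} → crossPolytope n F → CrossVertex x c e → CrossVertex y c′ e′ →
         F x ≡ true → F y ≡ true → Compatible Initial c e c′ e′
    go _ (fanᵛ i)   (fanᵛ j)   _ _ = inj₁ ¬Cross-common-start
    go noAntipodes (fanᵛ i) (shortᵛ j) Fx Fy = inj₁ λ cross →
      noAntipodes i (Fx , subst (λ k → F (n ↑ʳ k) ≡ true) (fan-short-cross cross) Fy)
    go noAntipodes (shortᵛ i) (fanᵛ j) Fx Fy = inj₁ λ cross →
      noAntipodes j (Fy , subst (λ k → F (n ↑ʳ k) ≡ true) (fan-short-cross (Cross-sym cross)) Fx)
    go _ (shortᵛ i) (shortᵛ j) _ _ = shorts-compatible (toℕ i) (toℕ j)
    antipodes-absent : Flag (CompatibleVia label₀ Initial) F → crossPolytope n F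
    antipodes-absent clique i (F+eᵢ , F-eᵢ) =
      antipodes-incompatible (toℕ i)
        (subst₂ (Compatibleᵈ Initial) (label₀-fan i) (label₀-short i) (clique _ _ F+eᵢ F-eᵢ))

  crossPolytopeStage : Stage Initial
  crossPolytopeStage = record
    { V = Fin (n + n) ; Δ = crossPolytope n ; history = base ; _≟ᵥ_ = Finₚ._≟_
    ; label = label₀ ; label-injective = label₀-injective ; label-present = label₀-present
    ; label-onto = label₀-onto ; flag = flag₀ }

  completeRow : ∀ r → r < n → Stage (Present (suc r) (n + 3))
  completeRow zero    0<n   =
    fillRow (s≤s z≤n) ℕₚ.≤-refl (ℕₚ.≤⇒≤′ (3+-≤-+3 0<n)) ℕₚ.≤-refl crossPolytopeStage
  completeRow (suc r) 1+r<n =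
    fillRow (s≤s z≤n) ℕₚ.≤-refl (ℕₚ.≤⇒≤′ (3+-≤-+3 1+r<n)) ℕₚ.≤-refl
      (Stage-cong (completed-row≈next-row r) (completeRow r (ℕₚ.<-trans (ℕₚ.n<1+n r) 1+r<n)))

  all-present : ∀ c e → 2 + c ≤ e → e < n + 3 → Present n (n + 3) c e
  all-present c e c+2≤e e<n+3 with ℕₚ.m≤n⇒m<n∨m≡n (3+-≤-+3⁻ (ℕₚ.≤-trans (s≤s c+2≤e) e<n+3))
  ... | inj₁ c<n = inj₁ c<n
  ... | inj₂ c≡n = inj₂ (inj₁ (c≡n , e<n+3))

  all-resolved : ∀ x y → Compatibleᵈ (Present n (n + 3)) x y → ¬ Crosses x y
  all-resolved _ _ (inj₁ ¬cross) = ¬cross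
  all-resolved x y (inj₂ (c , m , ¬P , at)) =
    ⊥-elim (¬P (uncurry (all-present c _) (resolvent-valid x y at)))

  realise : Stage (Present n (n + 3)) →
            Σ Set λ V → Σ (Complex V) λ Δ → FromCrossByEdgeSubdiv n V Δ × (associahedron n ≅ Δ)
  realise S = V , Δ , history , σ , iso
    where
    open Stage S
    vertex : Diag n → V
    vertex d = proj₁ (label-onto d (all-present _ _ (nonadj d) (bound d)))
    label-vertex : ∀ d → label (vertex d) ≡ d
    label-vertex d = proj₂ (label-onto d _)
    vertex-label : ∀ x → vertex (label x) ≡ x
    vertex-label x = label-injective (label-vertex (label x))
    σ : Diag n ⤖ V
    σ = mk⤖ ( (λ {d} {d′} vd≡vd′ → trans (sym (label-vertex d)) (trans (cong label vd≡vd′) (label-vertex d′)))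
            , (λ x → label x , λ { refl → vertex-label x }))
    iso : ∀ G → Δ G ⇔ associahedron n (G ∘ vertex)
    iso G = ⇔.trans (flag G) (mk⇔
      (λ clique d e Gd Ge → all-resolved d e
         (subst₂ (Compatibleᵈ (Present n (n + 3))) (label-vertex d) (label-vertex e) (clique _ _ Gd Ge)))
      (λ noncrossing x y Gx Gy → inj₁ (noncrossing (label x) (label y)
         (subst (λ z → G z ≡ true) (sym (vertex-label x)) Gx)
         (subst (λ z → G z ≡ true) (sym (vertex-label y)) Gy))))

corollary3p4 : (n : ℕ) → 1 ≤ n →
    Σ Set λ V → Σ (Complex V) λ Δ →
      FromCrossByEdgeSubdiv n V Δ × (associahedron n ≅ Δ)
corollary3p4 (suc s) _ = realise (completeRow s (ℕₚ.n<1+n s))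
  where open Construction (suc s)
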